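{- Let $p$ be a prime with $5 \mid p-1$, and let $k,q$ be positive integers with $p\nmid q$ and $\mathrm{ord}_{p^k}(q) = 5$. Then $$m(q,p^k) = \begin{cases} 3, & \text{if } p=11 \text{ and } k=1,\\ 4, & \text{if } p=61 \text{ and } k=1,\\ 5, & \text{otherwise.}\end{cases}$$
   Context: $\mathrm{ord}_e(q)$ denotes the multiplicative order of $q$ modulo $e$. For coprime positive integers $q,e$, $m(q,e)$ denotes the least positive integer $t$ such that there exist nonnegative integers $a_1,\ldots,a_t$ (repetitions allowed) with $q^{a_1}+\cdots+q^{a_t} \equiv 0 \pmod e$. -}

module Defs where

open import Data.Nat using (ℕ; zero; suc; _+_; _*_; _∸_; _^_; _≤_; _<_)
open import Data.Nat.Divisibility using (_∣_)
open import Data.List using (List; length; map)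
open import Data.Nat.ListAction using (sum)
open import Data.Product using (_×_; ∃-syntax)
open import Relation.Nullary using (¬_)
open import Relation.Binary.PropositionalEquality using (_≡_)

infix 4 _≋_[mod_]
_≋_[mod_] : ℕ → ℕ → ℕ → Set
a ≋ b [mod e ] = (e ∣ (a ∸ b)) × (e ∣ (b ∸ a))

IsOrder : ℕ → ℕ → ℕ → Set
IsOrder e q d =
  (0 < d) × (q ^ d ≋ 1 [mod e ]) ×
  (∀ d′ → 0 < d′ → d′ < d → ¬ (q ^ d′ ≋ 1 [mod e ]))

powSum : ℕ → List ℕ → ℕ
powSum q as = sum (map (q ^_) as)

Representable : ℕ → ℕ → ℕ → Set
Representable q e t = ∃[ as ] ((length as ≡ t) × (e ∣ powSum q as))

IsM : ℕ → ℕ → ℕ → Set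
IsM q e t =
  (0 < t) × Representable q e t ×
  (∀ t′ → 0 < t′ → t′ < t → ¬ Representable q e t′)

{-# OPTIONS --safe #-}
-- Since ord(q) = 5 and p ≠ 5, n = p^k divides Φ₅(q) = 1 + q + ⋯ + q⁴, so modulo n the
-- integer q behaves like a primitive fifth root of unity ζ; in particular m(q, n) ≤ 5.
-- If q^a₁ + ⋯ + q^a_t ≡ 0 (mod n), then n also divides the product of this sum with
-- Σ q^(2aᵢ), Σ q^(3aᵢ) and Σ q^(4aᵢ), which modulo Φ₅(q) is the norm N(ζ^a₁ + ⋯ + ζ^a_t) ∈ ℤ.
-- For t < 5 these norms, enumerated over all exponent residues, are 1, 16, 81, 256, and
-- also 11 when t ≥ 3 and 61 when t = 4. As p ≡ 1 (mod 5), only p^k = 11 with t ≥ 3 and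
-- p^k = 61 with t = 4 survive, and there a representation of length 3, resp. 4, is found
-- by searching the residues of order 5.
module Submission where

open import Defs
open import Data.Nat
open import Data.Nat.Properties
open import Data.Nat.DivMod
open import Data.Nat.Divisibility
open import Data.Nat.Primality
open import Data.Nat.ListAction using (sum)
open import Data.Nat.ListAction.Properties using (sum-++)
open import Data.Nat.Tactic.RingSolver using (solve-∀)
open import Data.Fin using (Fin; toℕ)
open import Data.Fin.Properties using (all?; any?; toℕ-fromℕ<)
open import Data.List using (List; []; _∷_; _++_; map; length; upTo)
open import Data.List.Properties using (map-++)
open import Data.List.Membership.DecPropositional _≟_ using (_∈_; _∈?_)
open import Data.List.Relation.Unary.Any using (here; there)
open import Data.Vec as Vec using (Vec; []; _∷_)
open import Data.Vec.Properties using (length-toList)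
open import Data.Product using (_×_; _,_; proj₁; proj₂; ∃; ∃-syntax)
open import Data.Product.Properties using (≡-dec)
open import Data.Sum using (_⊎_; inj₁; inj₂)
open import Function using (_∘_)
open import Relation.Nullary using (¬_; Dec; yes; no; ¬?; contradiction)
open import Relation.Nullary.Decidable
  using (True; toWitness; from-yes; map′; _×-dec_; _⊎-dec_; _→-dec_)
open import Relation.Unary using (Decidable)
open import Relation.Binary.PropositionalEquality

Φ₅ : ℕ → ℕ
Φ₅ q = powSum q (upTo 5)

powSum-++ : ∀ q as bs → powSum q (as ++ bs) ≡ powSum q as + powSum q bs
powSum-++ q as bs = trans (cong sum (map-++ (q ^_) as bs)) (sum-++ (map (q ^_) as) _)

powSum-shift : ∀ q a bs → powSum q (map (a +_) bs) ≡ q ^ a * powSum q bs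
powSum-shift q a [] = sym (*-zeroʳ (q ^ a))
powSum-shift q a (b ∷ bs) = begin
  q ^ (a + b) + powSum q (map (a +_) bs) ≡⟨ cong₂ _+_ (^-distribˡ-+-* q a b) (powSum-shift q a bs) ⟩
  q ^ a * q ^ b + q ^ a * powSum q bs    ≡⟨ *-distribˡ-+ (q ^ a) (q ^ b) _ ⟨
  q ^ a * (q ^ b + powSum q bs)          ∎
  where open ≡-Reasoning

infixr 7 _⊛_
_⊛_ : List ℕ → List ℕ → List ℕ
[] ⊛ bs = []
(a ∷ as) ⊛ bs = map (a +_) bs ++ as ⊛ bs

powSum-⊛ : ∀ q as bs → powSum q (as ⊛ bs) ≡ powSum q as * powSum q bs
powSum-⊛ q [] bs = refl
powSum-⊛ q (a ∷ as) bs = begin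
  powSum q (map (a +_) bs ++ as ⊛ bs)             ≡⟨ powSum-++ q (map (a +_) bs) (as ⊛ bs) ⟩
  powSum q (map (a +_) bs) + powSum q (as ⊛ bs)   ≡⟨ cong₂ _+_ (powSum-shift q a bs) (powSum-⊛ q as bs) ⟩
  q ^ a * powSum q bs + powSum q as * powSum q bs ≡⟨ *-distribʳ-+ (powSum q bs) (q ^ a) (powSum q as) ⟨
  (q ^ a + powSum q as) * powSum q bs             ∎
  where open ≡-Reasoning

-- The exponents of ∏ⱼ₌₁⁴ Σᵢ x^(j·aᵢ), whose value at x = ζ is the norm of Σᵢ ζ^aᵢ.
normExponents : List ℕ → List ℕ
normExponents as = as ⊛ map (2 *_) as ⊛ map (3 *_) as ⊛ map (4 *_) as

∣powSum⇒∣powSum-normExponents : ∀ {n q} as → n ∣ powSum q as → n ∣ powSum q (normExponents as)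
∣powSum⇒∣powSum-normExponents {n} {q} as n∣as =
  subst (n ∣_) (sym (powSum-⊛ q as _)) (∣m⇒∣m*n _ n∣as)

-- (c₀ , … , c₄) counts exponents by their residue modulo 5; it stands for
-- c₀ + c₁ζ + ⋯ + c₄ζ⁴, which is the integer c₀ − c₁ when it is balanced,
-- because 1 + ζ + ⋯ + ζ⁴ = 0.
Tally : Set
Tally = ℕ × ℕ × ℕ × ℕ × ℕ

bump : ℕ → Tally → Tally
bump 0 (c₀ , c₁ , c₂ , c₃ , c₄) = suc c₀ , c₁ , c₂ , c₃ , c₄
bump 1 (c₀ , c₁ , c₂ , c₃ , c₄) = c₀ , suc c₁ , c₂ , c₃ , c₄
bump 2 (c₀ , c₁ , c₂ , c₃ , c₄) = c₀ , c₁ , suc c₂ , c₃ , c₄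
bump 3 (c₀ , c₁ , c₂ , c₃ , c₄) = c₀ , c₁ , c₂ , suc c₃ , c₄
bump 4 (c₀ , c₁ , c₂ , c₃ , c₄) = c₀ , c₁ , c₂ , c₃ , suc c₄
bump _ c = c

tally : List ℕ → Tally
tally [] = 0 , 0 , 0 , 0 , 0
tally (a ∷ as) = bump (a % 5) (tally as)

evalTally : ℕ → Tally → ℕ
evalTally q (c₀ , c₁ , c₂ , c₃ , c₄) = c₀ + q * (c₁ + q * (c₂ + q * (c₃ + q * c₄)))

evalTally-bump : ∀ q {i} c → i < 5 → evalTally q (bump i c) ≡ q ^ i + evalTally q c
evalTally-bump q {0} c _ = refl
evalTally-bump q {1} (c₀ , c₁ , c₂ , c₃ , c₄) _ = shift₁ q c₀ c₁ (c₂ + q * (c₃ + q * c₄))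
  where
  shift₁ : ∀ x a b r → a + x * (1 + b + x * r) ≡ x * 1 + (a + x * (b + x * r))
  shift₁ = solve-∀
evalTally-bump q {2} (c₀ , c₁ , c₂ , c₃ , c₄) _ = shift₂ q c₀ c₁ c₂ (c₃ + q * c₄)
  where
  shift₂ : ∀ x a b c r → a + x * (b + x * (1 + c + x * r))
                        ≡ x * (x * 1) + (a + x * (b + x * (c + x * r)))
  shift₂ = solve-∀
evalTally-bump q {3} (c₀ , c₁ , c₂ , c₃ , c₄) _ = shift₃ q c₀ c₁ c₂ c₃ c₄
  where
  shift₃ : ∀ x a b c d e → a + x * (b + x * (c + x * (1 + d + x * e)))
                          ≡ x * (x * (x * 1)) + (a + x * (b + x * (c + x * (d + x * e))))
  shift₃ = solve-∀
evalTally-bump q {4} (c₀ , c₁ , c₂ , c₃ , c₄) _ = shift₄ q c₀ c₁ c₂ c₃ c₄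
  where
  shift₄ : ∀ x a b c d e → a + x * (b + x * (c + x * (d + x * (1 + e))))
                          ≡ x * (x * (x * (x * 1))) + (a + x * (b + x * (c + x * (d + x * e))))
  shift₄ = solve-∀
evalTally-bump q {suc (suc (suc (suc (suc _))))} c (s≤s (s≤s (s≤s (s≤s (s≤s ())))))

balanced : ℕ → ℕ → Tally
balanced N m = N + m , m , m , m , m

evalTally-balanced : ∀ q N m → evalTally q (balanced N m) ≡ m * Φ₅ q + N
evalTally-balanced = identity
  where
  identity : ∀ x N m → N + m + x * (m + x * (m + x * (m + x * m)))
                     ≡ m * (1 + (x * 1 + (x * (x * 1) + (x * (x * (x * 1))
                                 + (x * (x * (x * (x * 1))) + 0))))) + N
  identity = solve-∀

constantOf : Tally → ℕ
constantOf (c₀ , c₁ , _) = c₀ ∸ c₁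

IsBalanced : Tally → Set
IsBalanced T@(c₀ , c₁ , _) = T ≡ balanced (c₀ ∸ c₁) c₁

isBalanced? : Decidable IsBalanced
isBalanced? T@(_ , _ , _) = ≡-dec _≟_ (≡-dec _≟_ (≡-dec _≟_ (≡-dec _≟_ _≟_))) T _

∣evalTally⇒∣constantOf : ∀ {n q} T → IsBalanced T → n ∣ Φ₅ q → n ∣ evalTally q T → n ∣ constantOf T
∣evalTally⇒∣constantOf {n} {q} T@(c₀ , c₁ , _) T-balanced n∣Φ₅ n∣T =
  ∣m+n∣m⇒∣n n∣balanced (∣n⇒∣m*n c₁ n∣Φ₅)
  where
  n∣balanced : n ∣ c₁ * Φ₅ q + (c₀ ∸ c₁)
  n∣balanced = subst (n ∣_) (evalTally-balanced q (c₀ ∸ c₁) c₁)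
                     (subst (λ S → n ∣ evalTally q S) T-balanced n∣T)

PossibleNorm : ℕ → ℕ → Set
PossibleNorm t N = N ∈ 1 ∷ 16 ∷ 81 ∷ 256 ∷ [] ⊎ (3 ≤ t × N ≡ 11) ⊎ (t ≡ 4 × N ≡ 61)

possibleNorm? : ∀ t N → Dec (PossibleNorm t N)
possibleNorm? t N = N ∈? _ ⊎-dec (3 ≤? t ×-dec N ≟ 11) ⊎-dec (t ≟ 4 ×-dec N ≟ 61)

HasPossibleNorm : ℕ → List ℕ → Set
HasPossibleNorm t r =
  IsBalanced (tally (normExponents r)) × PossibleNorm t (constantOf (tally (normExponents r)))

hasPossibleNorm? : ∀ t r → Dec (HasPossibleNorm t r)
hasPossibleNorm? t r = isBalanced? _ ×-dec possibleNorm? t _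

all-vectors? : ∀ {m} n {P : Vec (Fin m) n → Set} → Decidable P → Dec (∀ v → P v)
all-vectors? zero P? = map′ (λ { p [] → p }) (λ h → h []) (P? [])
all-vectors? (suc n) P? =
  map′ (λ { h (x ∷ v) → h x v }) (λ h x v → h (x ∷ v)) (all? λ x → all-vectors? n (P? ∘ (x ∷_)))

any-vector? : ∀ {m} n {P : Vec (Fin m) n → Set} → Decidable P → Dec (∃ P)
any-vector? zero P? = map′ ([] ,_) (λ { ([] , p) → p }) (P? [])
any-vector? (suc n) P? =
  map′ (λ { (x , v , p) → x ∷ v , p }) (λ { (x ∷ v , p) → x , v , p })
       (any? λ x → any-vector? n (P? ∘ (x ∷_)))

exponents : ∀ {t} → Vec (Fin 5) t → List ℕ
exponents v = Vec.toList (Vec.map toℕ v)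

residues : (as : List ℕ) → Vec (Fin 5) (length as)
residues [] = []
residues (a ∷ as) = a mod 5 ∷ residues as

exponents-residues : ∀ as → exponents (residues as) ≡ map (_% 5) as
exponents-residues [] = refl
exponents-residues (a ∷ as) = cong₂ _∷_ (toℕ-fromℕ< (m%n<n a 5)) (exponents-residues as)

abstract
  short-sums-have-possible-norms : ∀ t → 0 < t → t < 5 →
    (v : Vec (Fin 5) t) → HasPossibleNorm t (exponents v)
  short-sums-have-possible-norms 1 _ _ = from-yes (all-vectors? 1 (hasPossibleNorm? 1 ∘ exponents))
  short-sums-have-possible-norms 2 _ _ = from-yes (all-vectors? 2 (hasPossibleNorm? 2 ∘ exponents))
  short-sums-have-possible-norms 3 _ _ = from-yes (all-vectors? 3 (hasPossibleNorm? 3 ∘ exponents))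
  short-sums-have-possible-norms 4 _ _ = from-yes (all-vectors? 4 (hasPossibleNorm? 4 ∘ exponents))
  short-sums-have-possible-norms (suc (suc (suc (suc (suc _))))) _ (s≤s (s≤s (s≤s (s≤s (s≤s ())))))

module Modulo (n : ℕ) .{{_ : NonZero n}} where

  infix 4 _≈_
  _≈_ : ℕ → ℕ → Set
  a ≈ b = a % n ≡ b % n

  ≤∧∣∸⇒≈ : ∀ {a b} → b ≤ a → n ∣ a ∸ b → a ≈ b
  ≤∧∣∸⇒≈ {a} {b} b≤a n∣a∸b = trans (cong (_% n) (sym (m∸n+n≡m b≤a))) (%-remove-+ˡ b n∣a∸b)

  ≋⇒≈ : ∀ {a b} → a ≋ b [mod n ] → a ≈ b
  ≋⇒≈ {a} {b} (n∣a∸b , n∣b∸a) with ≤-total b a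
  ... | inj₁ b≤a = ≤∧∣∸⇒≈ b≤a n∣a∸b
  ... | inj₂ a≤b = sym (≤∧∣∸⇒≈ a≤b n∣b∸a)

  ≈⇒∣∸ : ∀ {a b} → a ≈ b → n ∣ a ∸ b
  ≈⇒∣∸ {a} {b} a≈b = divides (a / n ∸ b / n) (begin
    a ∸ b                                   ≡⟨ cong₂ _∸_ (m≡m%n+[m/n]*n a n) (m≡m%n+[m/n]*n b n) ⟩
    (a % n + a / n * n) ∸ (b % n + b / n * n) ≡⟨ cong (λ r → (r + a / n * n) ∸ (b % n + b / n * n)) a≈b ⟩
    (b % n + a / n * n) ∸ (b % n + b / n * n) ≡⟨ [m+n]∸[m+o]≡n∸o (b % n) _ _ ⟩
    a / n * n ∸ b / n * n                   ≡⟨ *-distribʳ-∸ n (a / n) (b / n) ⟨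
    (a / n ∸ b / n) * n                     ∎)
    where open ≡-Reasoning

  ≈⇒≋ : ∀ {a b} → a ≈ b → a ≋ b [mod n ]
  ≈⇒≋ a≈b = ≈⇒∣∸ a≈b , ≈⇒∣∸ (sym a≈b)

  ∣-resp-≈ : ∀ {a b} → a ≈ b → n ∣ a → n ∣ b
  ∣-resp-≈ {a} {b} a≈b n∣a = m%n≡0⇒n∣m b n (trans (sym a≈b) (n∣m⇒m%n≡0 a n n∣a))

  %-≈ : ∀ a → a % n ≈ a
  %-≈ a = m%n%n≡m%n a n

  +-cong : ∀ {a a′ b b′} → a ≈ a′ → b ≈ b′ → a + b ≈ a′ + b′
  +-cong {a} {a′} {b} {b′} a≈a′ b≈b′ = begin
    (a + b) % n           ≡⟨ %-distribˡ-+ a b n ⟩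
    (a % n + b % n) % n   ≡⟨ cong₂ (λ x y → (x + y) % n) a≈a′ b≈b′ ⟩
    (a′ % n + b′ % n) % n ≡⟨ %-distribˡ-+ a′ b′ n ⟨
    (a′ + b′) % n         ∎
    where open ≡-Reasoning

  *-cong : ∀ {a a′ b b′} → a ≈ a′ → b ≈ b′ → a * b ≈ a′ * b′
  *-cong {a} {a′} {b} {b′} a≈a′ b≈b′ = begin
    (a * b) % n           ≡⟨ %-distribˡ-* a b n ⟩
    (a % n * (b % n)) % n ≡⟨ cong₂ (λ x y → (x * y) % n) a≈a′ b≈b′ ⟩
    (a′ % n * (b′ % n)) % n ≡⟨ %-distribˡ-* a′ b′ n ⟨
    (a′ * b′) % n         ∎
    where open ≡-Reasoning

  ^-cong : ∀ {a b} m → a ≈ b → a ^ m ≈ b ^ m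
  ^-cong zero a≈b = refl
  ^-cong (suc m) a≈b = *-cong a≈b (^-cong m a≈b)

  powSum-cong : ∀ {a b} as → a ≈ b → powSum a as ≈ powSum b as
  powSum-cong [] a≈b = refl
  powSum-cong (e ∷ as) a≈b = +-cong (^-cong e a≈b) (powSum-cong as a≈b)

  order5-≈ : ∀ {q} → IsOrder n q 5 → q ^ 5 ≈ 1 × ¬ q ≈ 1
  order5-≈ {q} (_ , q⁵≋1 , minimal) = ≋⇒≈ q⁵≋1 , q≉1
    where
    q≉1 : ¬ q ≈ 1
    q≉1 q≈1 = minimal 1 (s≤s z≤n) (s≤s (s≤s z≤n))
      (≈⇒≋ (subst (λ x → x % n ≡ 1 % n) (sym (*-identityʳ q)) q≈1))

  module _ {q} (q⁵≈1 : q ^ 5 ≈ 1) where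

    ^-≈-^% : ∀ a → q ^ a ≈ q ^ (a % 5)
    ^-≈-^% a = begin
      q ^ a % n                             ≡⟨ cong (λ e → q ^ e % n) (m≡m%n+[m/n]*n a 5) ⟩
      q ^ (a % 5 + a / 5 * 5) % n           ≡⟨ cong (_% n) (^-distribˡ-+-* q (a % 5) (a / 5 * 5)) ⟩
      q ^ (a % 5) * q ^ (a / 5 * 5) % n     ≡⟨ cong (λ e → q ^ (a % 5) * q ^ e % n) (*-comm (a / 5) 5) ⟩
      q ^ (a % 5) * q ^ (5 * (a / 5)) % n   ≡⟨ cong (λ x → q ^ (a % 5) * x % n) (^-*-assoc q 5 (a / 5)) ⟨
      q ^ (a % 5) * (q ^ 5) ^ (a / 5) % n   ≡⟨ *-cong {q ^ (a % 5)} refl (^-cong (a / 5) q⁵≈1) ⟩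
      q ^ (a % 5) * 1 ^ (a / 5) % n         ≡⟨ cong (λ x → q ^ (a % 5) * x % n) (^-zeroˡ (a / 5)) ⟩
      q ^ (a % 5) * 1 % n                   ≡⟨ cong (_% n) (*-identityʳ (q ^ (a % 5))) ⟩
      q ^ (a % 5) % n                       ∎
      where open ≡-Reasoning

    powSum-≈-residues : ∀ as → powSum q as ≈ powSum q (map (_% 5) as)
    powSum-≈-residues [] = refl
    powSum-≈-residues (a ∷ as) = +-cong (^-≈-^% a) (powSum-≈-residues as)

    powSum-≈-tally : ∀ as → powSum q as ≈ evalTally q (tally as)
    powSum-≈-tally [] = cong (_% n) (vanishing q)
      where
      vanishing : ∀ x → 0 ≡ x * (x * (x * (x * 0)))
      vanishing = solve-∀
    powSum-≈-tally (a ∷ as) =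
      trans (+-cong (^-≈-^% a) (powSum-≈-tally as))
            (cong (_% n) (sym (evalTally-bump q (tally as) (m%n<n a 5))))

    representable⇒∣norm : ∀ {t} → n ∣ Φ₅ q → 0 < t → t < 5 →
      Representable q n t → ∃[ N ] n ∣ N × PossibleNorm t N
    representable⇒∣norm n∣Φ₅ 0<t t<5 (as , refl , n∣as) =
      constantOf T , ∣evalTally⇒∣constantOf {q = q} T (proj₁ possible) n∣Φ₅ n∣T , proj₂ possible
      where
      r : List ℕ
      r = map (_% 5) as
      T : Tally
      T = tally (normExponents r)
      possible : HasPossibleNorm (length as) r
      possible = subst (HasPossibleNorm (length as)) (exponents-residues as)
                       (short-sums-have-possible-norms _ 0<t t<5 (residues as))
      n∣T : n ∣ evalTally q T
      n∣T = ∣-resp-≈ (powSum-≈-tally (normExponents r))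
              (∣powSum⇒∣powSum-normExponents r (∣-resp-≈ (powSum-≈-residues as) n∣as))

  module _ (t : ℕ) where

    OrderFiveResiduesRepresentable : Set
    OrderFiveResiduesRepresentable =
      ∀ {r} → r < n → r ^ 5 ≈ 1 → ¬ r ≈ 1 → ∃[ v ] n ∣ powSum r (exponents {t} v)

    orderFiveResiduesRepresentable? : Dec OrderFiveResiduesRepresentable
    orderFiveResiduesRepresentable? = allUpTo?
      (λ r → r ^ 5 % n ≟ 1 % n →-dec ¬? (r % n ≟ 1 % n) →-dec
             any-vector? t (λ v → n ∣? powSum r (exponents v)))
      n

    representable-by-search : {_ : True orderFiveResiduesRepresentable?} →
      ∀ {q} → IsOrder n q 5 → Representable q n t
    representable-by-search {searched} {q} ord =
      exponents v , length-toList (Vec.map toℕ v) ,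
      ∣-resp-≈ (powSum-cong (exponents v) (%-≈ q)) (proj₂ witness)
      where
      r⁵≈1 : (q % n) ^ 5 ≈ 1
      r⁵≈1 = trans (^-cong 5 (%-≈ q)) (proj₁ (order5-≈ ord))
      r≉1 : ¬ q % n ≈ 1
      r≉1 r≈1 = proj₂ (order5-≈ ord) (trans (sym (%-≈ q)) r≈1)
      witness : ∃[ v ] n ∣ powSum (q % n) (exponents {t} v)
      witness = toWitness searched (m%n<n q n) r⁵≈1 r≉1
      v : Vec (Fin 5) t
      v = proj₁ witness

^suc∣⇒∣ : ∀ {p k d} → p ^ suc k ∣ d → p ∣ d
^suc∣⇒∣ {p} {k} = ∣-trans (m∣m*n (p ^ k))

PrimeOneMod5 : ℕ → Set
PrimeOneMod5 p = Prime p × 5 ∣ p ∸ 1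

primeOneMod5? : Decidable PrimeOneMod5
primeOneMod5? p = prime? p ×-dec 5 ∣? p ∸ 1

no-primeOneMod5-divisor : ∀ N .{{_ : NonZero N}} →
  {_ : True (allUpTo? (λ d → d ∣? N →-dec ¬? (primeOneMod5? d)) (suc N))} →
  ∀ {p} → p ∣ N → ¬ PrimeOneMod5 p
no-primeOneMod5-divisor N {searched} p∣N = toWitness searched (s≤s (∣⇒≤ p∣N)) p∣N

^-∣-self⇒≡1 : ∀ {p k} → 1 < p → 0 < k → p ^ k ∣ p → k ≡ 1
^-∣-self⇒≡1 {p} {suc zero} _ _ _ = refl
^-∣-self⇒≡1 {p} {suc (suc k)} 1<p _ p²⁺ᵏ∣p = contradiction (m*n≡1⇒m≡1 p _ (∣1⇒≡1 pᵏ⁺¹∣1)) (>⇒≢ 1<p)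
  where
  instance
    _ : NonZero p
    _ = >-nonZero (<-trans (s≤s z≤n) 1<p)
  pᵏ⁺¹∣1 : p * p ^ k ∣ 1
  pᵏ⁺¹∣1 = *-cancelˡ-∣ p (subst (p * (p * p ^ k) ∣_) (sym (*-identityʳ p)) p²⁺ᵏ∣p)

prime-power∣prime : ∀ {p k N} → Prime p → Prime N → 0 < k → p ^ k ∣ N → p ≡ N × k ≡ 1
prime-power∣prime {p} {suc k} p-prime N-prime _ pᵏ∣N with prime⇒irreducible N-prime {p} (^suc∣⇒∣ {k = k} pᵏ∣N)
... | inj₁ refl = contradiction p-prime λ ()
... | inj₂ refl = refl , ^-∣-self⇒≡1 (nonTrivial⇒n>1 p {{prime⇒nonTrivial p-prime}}) (s≤s z≤n) pᵏ∣N

data Exceptional : ℕ → ℕ → ℕ → Set where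
  eleven    : ∀ {t} → 3 ≤ t → Exceptional t 11 1
  sixty-one : Exceptional 4 61 1

possibleNorm⇒exceptional : ∀ {t N p k} → PrimeOneMod5 p → 0 < k → p ^ k ∣ N → PossibleNorm t N →
  Exceptional t p k
possibleNorm⇒exceptional {p = p} {suc k} p≡1mod5 _ pᵏ∣N (inj₁ N∈) =
  contradiction p≡1mod5 (no-divisor N∈ (^suc∣⇒∣ {k = k} pᵏ∣N))
  where
  no-divisor : ∀ {N} → N ∈ 1 ∷ 16 ∷ 81 ∷ 256 ∷ [] → p ∣ N → ¬ PrimeOneMod5 p
  no-divisor (here refl) = no-primeOneMod5-divisor 1
  no-divisor (there (here refl)) = no-primeOneMod5-divisor 16
  no-divisor (there (there (here refl))) = no-primeOneMod5-divisor 81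
  no-divisor (there (there (there (here refl)))) = no-primeOneMod5-divisor 256
possibleNorm⇒exceptional (p-prime , _) 0<k pᵏ∣N (inj₂ (inj₁ (3≤t , refl)))
  with prime-power∣prime p-prime (from-yes (prime? 11)) 0<k pᵏ∣N
... | refl , refl = eleven 3≤t
possibleNorm⇒exceptional (p-prime , _) 0<k pᵏ∣N (inj₂ (inj₂ (refl , refl)))
  with prime-power∣prime p-prime (from-yes (prime? 61)) 0<k pᵏ∣N
... | refl , refl = sixty-one

prime^k∣m*n⇒∣n : ∀ {p} k {m n} → Prime p → ¬ p ∣ m → p ^ k ∣ m * n → p ^ k ∣ n
prime^k∣m*n⇒∣n zero _ _ _ = 1∣ _
prime^k∣m*n⇒∣n {p} (suc k) {m} {n} p-prime p∤m pᵏ⁺¹∣mn with euclidsLemma m n p-prime (^suc∣⇒∣ {k = k} pᵏ⁺¹∣mn)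
... | inj₁ p∣m = contradiction p∣m p∤m
... | inj₂ (divides c refl) = subst (_∣ c * p) (*-comm (p ^ k) p) (*-monoˡ-∣ p pᵏ∣c)
  where
  instance
    _ : NonZero p
    _ = prime⇒nonZero p-prime
  rearrange : ∀ a b x → a * (b * x) ≡ x * (a * b)
  rearrange = solve-∀
  pᵏ∣c : p ^ k ∣ c
  pᵏ∣c = prime^k∣m*n⇒∣n k p-prime p∤m (*-cancelˡ-∣ p (subst (p * p ^ k ∣_) (rearrange m c p) pᵏ⁺¹∣mn))

[1+y]^5≡1+y*Φ₅[1+y] : ∀ y → suc y ^ 5 ≡ 1 + y * Φ₅ (suc y)
[1+y]^5≡1+y*Φ₅[1+y] = identity
  where
  identity : ∀ y → (1 + y) * ((1 + y) * ((1 + y) * ((1 + y) * ((1 + y) * 1))))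
    ≡ 1 + y * (1 + ((1 + y) * 1 + ((1 + y) * ((1 + y) * 1) + ((1 + y) * ((1 + y) * ((1 + y) * 1))
                 + ((1 + y) * ((1 + y) * ((1 + y) * ((1 + y) * 1))) + 0)))))
  identity = solve-∀

∣Φ₅[1+y]⇒∣5 : ∀ {d y} → d ∣ y → d ∣ Φ₅ (suc y) → d ∣ 5
∣Φ₅[1+y]⇒∣5 {d} {y} d∣y d∣Φ₅ = ∣m+n∣m⇒∣n (subst (d ∣_) (identity y) d∣Φ₅) (∣m⇒∣m*n _ d∣y)
  where
  identity : ∀ y → 1 + ((1 + y) * 1 + ((1 + y) * ((1 + y) * 1) + ((1 + y) * ((1 + y) * ((1 + y) * 1))
                 + ((1 + y) * ((1 + y) * ((1 + y) * ((1 + y) * 1))) + 0))))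
    ≡ y * (10 + y * (10 + y * (5 + y))) + 5
  identity = solve-∀

prime^k≢0 : ∀ {p} k → Prime p → NonZero (p ^ k)
prime^k≢0 {p} k p-prime = m^n≢0 p k {{prime⇒nonZero p-prime}}

order5⇒∣Φ₅ : ∀ {p k q} → PrimeOneMod5 p → IsOrder (p ^ k) q 5 → p ^ k ∣ Φ₅ q
order5⇒∣Φ₅ {p} {k} {q} p≡1mod5@(p-prime , _) ord = pᵏ∣Φ₅ q (proj₁ (order5-≈ ord)) (proj₂ (order5-≈ ord))
  where
  instance
    _ : NonZero (p ^ k)
    _ = prime^k≢0 k p-prime
  open Modulo (p ^ k)
  pᵏ∣yΦ₅ : ∀ y → suc y ^ 5 ≈ 1 → p ^ k ∣ y * Φ₅ (suc y)
  pᵏ∣yΦ₅ y q⁵≈1 = ≈⇒∣∸ (subst (_≈ 1) ([1+y]^5≡1+y*Φ₅[1+y] y) q⁵≈1)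
  pᵏ∣Φ₅ : ∀ q → q ^ 5 ≈ 1 → ¬ q ≈ 1 → p ^ k ∣ Φ₅ q
  pᵏ∣Φ₅ zero q⁵≈1 _ = ≈⇒∣∸ (sym q⁵≈1)
  pᵏ∣Φ₅ (suc y) q⁵≈1 q≉1 with p ∣? y
  ... | no p∤y = prime^k∣m*n⇒∣n k p-prime p∤y (pᵏ∣yΦ₅ y q⁵≈1)
  ... | yes p∣y = contradiction (≤∧∣∸⇒≈ (s≤s z≤n) pᵏ∣y) q≉1
    where
    p∤Φ₅ : ¬ p ∣ Φ₅ (suc y)
    p∤Φ₅ p∣Φ₅ = no-primeOneMod5-divisor 5 (∣Φ₅[1+y]⇒∣5 p∣y p∣Φ₅) p≡1mod5
    pᵏ∣y : p ^ k ∣ y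
    pᵏ∣y = prime^k∣m*n⇒∣n k p-prime p∤Φ₅ (subst (p ^ k ∣_) (*-comm y _) (pᵏ∣yΦ₅ y q⁵≈1))

short-representation⇒exceptional : ∀ {p k q t} → PrimeOneMod5 p → 0 < k → IsOrder (p ^ k) q 5 →
  0 < t → t < 5 → Representable q (p ^ k) t → Exceptional t p k
short-representation⇒exceptional {p} {k} {q} {t} p≡1mod5@(p-prime , _) 0<k ord 0<t t<5 rep =
  possibleNorm⇒exceptional p≡1mod5 0<k (proj₁ (proj₂ norm)) (proj₂ (proj₂ norm))
  where
  instance
    _ : NonZero (p ^ k)
    _ = prime^k≢0 k p-prime
  open Modulo (p ^ k)
  norm : ∃[ N ] p ^ k ∣ N × PossibleNorm t N
  norm = representable⇒∣norm (proj₁ (order5-≈ ord)) (order5⇒∣Φ₅ {p} {k} {q} p≡1mod5 ord) 0<t t<5 rep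

no-representation-below : ∀ {p k q s} → PrimeOneMod5 p → 0 < k → IsOrder (p ^ k) q 5 → s ≤ 5 →
  (∀ {t} → t < s → ¬ Exceptional t p k) → ∀ t → 0 < t → t < s → ¬ Representable q (p ^ k) t
no-representation-below p≡1mod5 0<k ord s≤5 unexceptional t 0<t t<s rep =
  unexceptional t<s (short-representation⇒exceptional p≡1mod5 0<k ord 0<t (<-≤-trans t<s s≤5) rep)

-- The hypotheses 0 < q and p ∤ q are implied by the order hypothesis.
proposition14 : (p k q : ℕ) → Prime p → 5 ∣ (p ∸ 1) → 0 < k → 0 < q →
    ¬ (p ∣ q) → IsOrder (p ^ k) q 5 →
    ((p ≡ 11 × k ≡ 1) × IsM q (p ^ k) 3)
    ⊎ ((p ≡ 61 × k ≡ 1) × IsM q (p ^ k) 4)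
    ⊎ ((¬ (p ≡ 11 × k ≡ 1)) × (¬ (p ≡ 61 × k ≡ 1)) × IsM q (p ^ k) 5)
proposition14 p k q p-prime 5∣p∸1 0<k _ _ ord with p ≟ 11 ×-dec k ≟ 1 | p ≟ 61 ×-dec k ≟ 1
... | yes (refl , refl) | _ =
  inj₁ ((refl , refl) , s≤s z≤n , Modulo.representable-by-search 11 3 ord ,
        no-representation-below (p-prime , 5∣p∸1) 0<k ord (m≤n+m 3 2)
          λ { t<3 (eleven 3≤t) → <⇒≱ t<3 3≤t })
... | no _ | yes (refl , refl) =
  inj₂ (inj₁ ((refl , refl) , s≤s z≤n , Modulo.representable-by-search 61 4 ord ,
              no-representation-below (p-prime , 5∣p∸1) 0<k ord (m≤n+m 4 1)
                λ { t<4 sixty-one → <-irrefl refl t<4 }))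
... | no not-11 | no not-61 =
  inj₂ (inj₂ (not-11 , not-61 , s≤s z≤n ,
              (upTo 5 , refl , order5⇒∣Φ₅ {p} {k} {q} (p-prime , 5∣p∸1) ord) ,
              no-representation-below (p-prime , 5∣p∸1) 0<k ord ≤-refl
                λ { _ (eleven _) → not-11 (refl , refl) ; _ sixty-one → not-61 (refl , refl) }))
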